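{- Let $m\ge1$, $\zeta\in\overline{\mathbb F}_2$ a primitive $(4^m-1)$-th root of unity and $\omega=\zeta^{(4^m-1)/3}$. Let $I\subseteq\{0,\dots,2m-1\}$ with $|I|=k$, and let $0\le u<4^m-1$ satisfy $\zeta^u=\omega^{ -1}\zeta^{\sum_{i\in I}(-2)^i}$. Then $O(u)-E(u)=m-k$. In particular $\mathrm{wt}_2(u)$ is even if and only if $m-k$ is even.
   Context: For $0\le u\le4^m-1$ write $u=\sum_{i=0}^{2m-1}u_i2^i$ with $u_i\in\{0,1\}$; $\mathrm{wt}_2(u)=\sum_iu_i$, $O(u)=\#\{0\le i\le m-1:u_{2i+1}=1\}$, $E(u)=\#\{0\le i\le m-1:u_{2i}=1\}$. -}

module Defs where

open import Level using (Level)
open import Data.Nat using (ℕ; zero; suc; _+_; _*_; _∸_; _^_; _/_; _%_; _<_)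
open import Data.Bool using (Bool; true; false; if_then_else_)
open import Data.Fin using (Fin; toℕ)
open import Data.Fin.Subset using (Subset; _∈_)
open import Data.Fin.Subset.Properties using (_∈?_)
open import Data.Vec using (lookup)
open import Relation.Nullary using (¬_; yes; no)
open import Algebra.Bundles using (CommutativeRing)

N : ℕ → ℕ
N m = 4 ^ m ∸ 1

bit : ℕ → ℕ → ℕ
bit u zero    = u % 2
bit u (suc i) = bit (u / 2) i

sumTo : ℕ → (ℕ → ℕ) → ℕ
sumTo zero    f = 0
sumTo (suc n) f = sumTo n f + f n

wt₂ : ℕ → ℕ → ℕ
wt₂ m u = sumTo (2 * m) (bit u)

Ocount : ℕ → ℕ → ℕ
Ocount m u = sumTo m (λ i → bit u (suc (2 * i)))

Ecount : ℕ → ℕ → ℕ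
Ecount m u = sumTo m (λ i → bit u (2 * i))

-- For I ⊆ {0,…,n-1}: Σ_{i∈I, i even} 2^i  and  Σ_{i∈I, i odd} 2^i,
-- so that Σ_{i∈I} (-2)^i = posPart I - negPart I.
posPart : ∀ {n} → Subset n → ℕ
posPart {n} I = sumTo n λ i → term i
  where
  term : ℕ → ℕ
  term i with Data.Nat._<?_ i n
  ... | no _ = 0
  ... | yes i<n with Data.Fin.fromℕ< i<n ∈? I | i % 2
  ...   | yes _ | 0 = 2 ^ i
  ...   | _     | _ = 0

negPart : ∀ {n} → Subset n → ℕ
negPart {n} I = sumTo n λ i → term i
  where
  term : ℕ → ℕ
  term i with Data.Nat._<?_ i n
  ... | no _ = 0
  ... | yes i<n with Data.Fin.fromℕ< i<n ∈? I | i % 2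
  ...   | yes _ | 1 = 2 ^ i
  ...   | _     | _ = 0

module _ {c ℓ : Level} (R : CommutativeRing c ℓ) where
  open CommutativeRing R using (Carrier; _≈_; 1#; 0#) renaming (_*_ to _·_; _+_ to _⊕_)
  open import Data.Product using (_×_)

  pow : Carrier → ℕ → Carrier
  pow x zero    = 1#
  pow x (suc n) = x · pow x n

  Char2 : Set ℓ
  Char2 = 1# ⊕ 1# ≈ 0#

  PrimitiveRoot : ℕ → Carrier → Set ℓ
  PrimitiveRoot n ζ = (pow ζ n ≈ 1#) × (∀ j → 0 < j → j < n → ¬ (pow ζ j ≈ 1#))

module Submission where

-- Write N = 4^m - 1 and, for I ⊆ {0,…,2m-1}, let a_j = [2j ∈ I],
-- b_j = [2j+1 ∈ I] and c_j = 1 - b_j.  The number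
--     v = Σ_{j<m} (a_j + 2 c_j) 4^j,
-- whose binary digits are a_0 c_0 a_1 c_1 …, satisfies the identity of natural
-- numbers  v + N/3 + Σ_{i∈I odd} 2^i = Σ_{i∈I even} 2^i + N,  because
-- N/3 = Σ 4^j and c_j + b_j = 1.  As ζ^N = 1 and powers of ζ can be cancelled,
-- the hypothesis gives ζ^u = ζ^v, and since ζ is primitive and u < N, v ≤ N,
-- either u = v or (u = 0 and v = N).  Reading off binary digits,
-- O(v) + |I| = Σ c_j + Σ (a_j + b_j) = m + E(v); in the exceptional case all
-- digits of v = N are 1, so |I| = m and O(0) = E(0) = 0.  Either way
-- O(u) + |I| = m + E(u), from which both conclusions are integer bookkeeping.

open import Defs
open import Level using (Level)
open import Function using (_∘_; const)
open import Function.Bundles using (_⇔_; mk⇔; Equivalence)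
open import Data.Nat
open import Data.Nat.Properties
open import Data.Nat.DivMod
open import Data.Nat.Divisibility using (m∣m*n)
open import Data.Nat.Tactic.RingSolver using (solve-∀)
open import Data.Bool using (true; false; if_then_else_)
open import Data.Vec using ([]; _∷_)
open import Data.Vec.Base using (here; there)
open import Data.Fin using (fromℕ<)
open import Data.Fin.Subset using (Subset; ∣_∣; _∈_)
open import Data.Fin.Subset.Properties using (_∈?_)
open import Data.Integer as ℤ using (ℤ; +_; _-_)
import Data.Integer.Properties as ℤ
import Data.Integer.Tactic.RingSolver as ℤ-Solver
open import Data.Integer.Divisibility using (_∣_)
import Data.Integer.Divisibility.Signed as Signed
open import Data.Product using (_×_; _,_)
open import Data.Sum using (inj₁; inj₂)
open import Data.Empty using (⊥-elim)
open import Relation.Nullary using (¬_; yes; no)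
open import Relation.Binary.Definitions using (tri<; tri≈; tri>)
open import Relation.Binary.PropositionalEquality using (_≡_; refl; sym; trans; cong; cong₂; subst; module ≡-Reasoning)
open import Algebra.Bundles using (CommutativeRing)
import Algebra.Properties.Semiring.Exp as Exp
import Relation.Binary.Reasoning.Setoid as SetoidReasoning

sumTo-ext : ∀ n {f g : ℕ → ℕ} → (∀ i → i < n → f i ≡ g i) → sumTo n f ≡ sumTo n g
sumTo-ext zero    f≗g = refl
sumTo-ext (suc n) f≗g =
  cong₂ _+_ (sumTo-ext n (λ i i<n → f≗g i (m<n⇒m<1+n i<n))) (f≗g n ≤-refl)

sumTo-+ : ∀ n f g → sumTo n f + sumTo n g ≡ sumTo n (λ i → f i + g i)
sumTo-+ zero    f g = refl
sumTo-+ (suc n) f g = begin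
  (sumTo n f + f n) + (sumTo n g + g n) ≡⟨ interchange (sumTo n f) (f n) (sumTo n g) (g n) ⟩
  (sumTo n f + sumTo n g) + (f n + g n) ≡⟨ cong (_+ (f n + g n)) (sumTo-+ n f g) ⟩
  sumTo n (λ i → f i + g i) + (f n + g n) ∎
  where
  open ≡-Reasoning
  interchange : ∀ a b c d → (a + b) + (c + d) ≡ (a + c) + (b + d)
  interchange = solve-∀

sumTo-*ˡ : ∀ n k f → k * sumTo n f ≡ sumTo n (λ i → k * f i)
sumTo-*ˡ zero    k f = *-zeroʳ k
sumTo-*ˡ (suc n) k f =
  trans (*-distribˡ-+ k (sumTo n f) (f n)) (cong (_+ k * f n) (sumTo-*ˡ n k f))

sumTo-mono : ∀ n {f g : ℕ → ℕ} → (∀ i → f i ≤ g i) → sumTo n f ≤ sumTo n g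
sumTo-mono zero    f≤g = z≤n
sumTo-mono (suc n) f≤g = +-mono-≤ (sumTo-mono n f≤g) (f≤g n)

sumTo-const : ∀ n k → sumTo n (const k) ≡ n * k
sumTo-const zero    k = refl
sumTo-const (suc n) k = trans (cong (_+ k) (sumTo-const n k)) (+-comm (n * k) k)

sumTo-ones : ∀ n → sumTo n (const 1) ≡ n
sumTo-ones n = trans (sumTo-const n 1) (*-identityʳ n)

sumTo-shift : ∀ n f → sumTo (suc n) f ≡ f 0 + sumTo n (f ∘ suc)
sumTo-shift zero    f = +-comm 0 (f 0)
sumTo-shift (suc n) f =
  trans (cong (_+ f (suc n)) (sumTo-shift n f)) (+-assoc (f 0) _ _)

sumTo-pairs : ∀ m f → sumTo (2 * m) f ≡ sumTo m (λ j → f (2 * j) + f (suc (2 * j)))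
sumTo-pairs zero    f = refl
sumTo-pairs (suc m) f = begin
  sumTo (2 * suc m) f                                   ≡⟨ cong (λ n → sumTo n f) (*-suc 2 m) ⟩
  sumTo (2 * m) f + f (2 * m) + f (suc (2 * m))         ≡⟨ +-assoc (sumTo (2 * m) f) _ _ ⟩
  sumTo (2 * m) f + (f (2 * m) + f (suc (2 * m)))       ≡⟨ cong (_+ (f (2 * m) + f (suc (2 * m)))) (sumTo-pairs m f) ⟩
  sumTo m (λ j → f (2 * j) + f (suc (2 * j))) + (f (2 * m) + f (suc (2 * m))) ∎
  where open ≡-Reasoning

IsBinary : (ℕ → ℕ) → Set
IsBinary a = ∀ j → a j < 2

bit-zero-digit : ∀ r q → r < 2 → bit (r + 2 * q) 0 ≡ r
bit-zero-digit r q r<2 = trans (%-remove-+ʳ r (m∣m*n q)) (m<n⇒m%n≡m r<2)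

bit-suc-digit : ∀ r q i → r < 2 → bit (r + 2 * q) (suc i) ≡ bit q i
bit-suc-digit r q i r<2 = cong (λ x → bit x i) halve
  where
  open ≡-Reasoning
  halve : (r + 2 * q) / 2 ≡ q
  halve = begin
    (r + 2 * q) / 2     ≡⟨ +-distrib-/-∣ʳ r (m∣m*n q) ⟩
    r / 2 + 2 * q / 2   ≡⟨ cong₂ _+_ (m<n⇒m/n≡0 r<2) (cong (_/ 2) (*-comm 2 q)) ⟩
    q * 2 / 2           ≡⟨ m*n/n≡m q 2 ⟩
    q                   ∎

bit-of-zero : ∀ i → bit 0 i ≡ 0
bit-of-zero zero    = refl
bit-of-zero (suc i) = bit-of-zero i

interleave : ℕ → (ℕ → ℕ) → (ℕ → ℕ) → ℕ
interleave zero    a c = 0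
interleave (suc m) a c = a 0 + 2 * (c 0 + 2 * interleave m (a ∘ suc) (c ∘ suc))

bit-interleave-shift : ∀ m a c i → a 0 < 2 → c 0 < 2 →
  bit (interleave (suc m) a c) (suc (suc i)) ≡ bit (interleave m (a ∘ suc) (c ∘ suc)) i
bit-interleave-shift m a c i a0<2 c0<2 =
  trans (bit-suc-digit (a 0) (c 0 + 2 * rest) (suc i) a0<2) (bit-suc-digit (c 0) rest i c0<2)
  where
  rest : ℕ
  rest = interleave m (a ∘ suc) (c ∘ suc)

bit-interleave-even : ∀ m a c → IsBinary a → IsBinary c →
  ∀ j → j < m → bit (interleave m a c) (2 * j) ≡ a j
bit-interleave-even (suc m) a c a-bin c-bin zero    _         =
  bit-zero-digit (a 0) (c 0 + 2 * interleave m (a ∘ suc) (c ∘ suc)) (a-bin 0)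
bit-interleave-even (suc m) a c a-bin c-bin (suc j) (s≤s j<m) = begin
  bit (interleave (suc m) a c) (2 * suc j)          ≡⟨ cong (bit (interleave (suc m) a c)) (*-suc 2 j) ⟩
  bit (interleave (suc m) a c) (suc (suc (2 * j)))  ≡⟨ bit-interleave-shift m a c (2 * j) (a-bin 0) (c-bin 0) ⟩
  bit (interleave m (a ∘ suc) (c ∘ suc)) (2 * j)    ≡⟨ bit-interleave-even m (a ∘ suc) (c ∘ suc) (a-bin ∘ suc) (c-bin ∘ suc) j j<m ⟩
  a (suc j)                                         ∎
  where open ≡-Reasoning

bit-interleave-odd : ∀ m a c → IsBinary a → IsBinary c →
  ∀ j → j < m → bit (interleave m a c) (suc (2 * j)) ≡ c j
bit-interleave-odd (suc m) a c a-bin c-bin zero    _         =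
  trans (bit-suc-digit (a 0) (c 0 + 2 * rest) 0 (a-bin 0)) (bit-zero-digit (c 0) rest (c-bin 0))
  where
  rest : ℕ
  rest = interleave m (a ∘ suc) (c ∘ suc)
bit-interleave-odd (suc m) a c a-bin c-bin (suc j) (s≤s j<m) = begin
  bit (interleave (suc m) a c) (suc (2 * suc j))          ≡⟨ cong (bit (interleave (suc m) a c) ∘ suc) (*-suc 2 j) ⟩
  bit (interleave (suc m) a c) (suc (suc (suc (2 * j))))  ≡⟨ bit-interleave-shift m a c (suc (2 * j)) (a-bin 0) (c-bin 0) ⟩
  bit (interleave m (a ∘ suc) (c ∘ suc)) (suc (2 * j))    ≡⟨ bit-interleave-odd m (a ∘ suc) (c ∘ suc) (a-bin ∘ suc) (c-bin ∘ suc) j j<m ⟩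
  c (suc j)                                               ∎
  where open ≡-Reasoning

Ecount-interleave : ∀ m a c → IsBinary a → IsBinary c → Ecount m (interleave m a c) ≡ sumTo m a
Ecount-interleave m a c a-bin c-bin = sumTo-ext m (bit-interleave-even m a c a-bin c-bin)

Ocount-interleave : ∀ m a c → IsBinary a → IsBinary c → Ocount m (interleave m a c) ≡ sumTo m c
Ocount-interleave m a c a-bin c-bin = sumTo-ext m (bit-interleave-odd m a c a-bin c-bin)

interleave-sum : ∀ m a c → interleave m a c ≡ sumTo m (λ j → (a j + 2 * c j) * 4 ^ j)
interleave-sum zero    a c = refl
interleave-sum (suc m) a c = sym (begin
  sumTo (suc m) (λ j → d j * 4 ^ j)                ≡⟨ sumTo-shift m (λ j → d j * 4 ^ j) ⟩
  d 0 * 1 + sumTo m (λ j → d (suc j) * (4 * 4 ^ j)) ≡⟨ cong (λ x → d 0 * 1 + x) (sumTo-ext m (λ j _ → *-comm-4 (d (suc j)) (4 ^ j))) ⟩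
  d 0 * 1 + sumTo m (λ j → 4 * (d (suc j) * 4 ^ j)) ≡⟨ cong (λ x → d 0 * 1 + x) (sym (sumTo-*ˡ m 4 (λ j → d (suc j) * 4 ^ j))) ⟩
  d 0 * 1 + 4 * sumTo m (λ j → d (suc j) * 4 ^ j)   ≡⟨ cong (λ x → d 0 * 1 + 4 * x) (sym (interleave-sum m (a ∘ suc) (c ∘ suc))) ⟩
  d 0 * 1 + 4 * rest                                ≡⟨ regroup (a 0) (c 0) rest ⟩
  interleave (suc m) a c                            ∎)
  where
  open ≡-Reasoning
  d : ℕ → ℕ
  d j = a j + 2 * c j
  rest : ℕ
  rest = interleave m (a ∘ suc) (c ∘ suc)
  *-comm-4 : ∀ x y → x * (4 * y) ≡ 4 * (x * y)
  *-comm-4 = solve-∀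
  regroup : ∀ x y z → (x + 2 * y) * 1 + 4 * z ≡ x + 2 * (y + 2 * z)
  regroup = solve-∀

wt₂-split : ∀ m u → wt₂ m u ≡ Ecount m u + Ocount m u
wt₂-split m u = trans (sumTo-pairs m (bit u)) (sym (sumTo-+ m _ _))

Ecount-zero : ∀ m → Ecount m 0 ≡ 0
Ecount-zero m = trans (sumTo-ext m (λ j _ → bit-of-zero (2 * j))) (trans (sumTo-const m 0) (*-zeroʳ m))

Ocount-zero : ∀ m → Ocount m 0 ≡ 0
Ocount-zero m = trans (sumTo-ext m (λ j _ → bit-of-zero (suc (2 * j)))) (trans (sumTo-const m 0) (*-zeroʳ m))

geometric : ∀ m → sumTo m (λ j → 3 * 4 ^ j) + 1 ≡ 4 ^ m
geometric zero    = refl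
geometric (suc m) = begin
  s + 3 * 4 ^ m + 1     ≡⟨ swap s (4 ^ m) ⟩
  (s + 1) + 3 * 4 ^ m   ≡⟨ cong (_+ 3 * 4 ^ m) (geometric m) ⟩
  4 ^ m + 3 * 4 ^ m     ≡⟨ times4 (4 ^ m) ⟩
  4 * 4 ^ m             ∎
  where
  open ≡-Reasoning
  s : ℕ
  s = sumTo m (λ j → 3 * 4 ^ j)
  swap : ∀ s x → s + 3 * x + 1 ≡ (s + 1) + 3 * x
  swap = solve-∀
  times4 : ∀ x → x + 3 * x ≡ 4 * x
  times4 = solve-∀

N-sum : ∀ m → N m ≡ sumTo m (λ j → 3 * 4 ^ j)
N-sum m = trans (cong (_∸ 1) (sym (geometric m))) (m+n∸n≡m _ 1)

N/3-sum : ∀ m → N m / 3 ≡ sumTo m (4 ^_)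
N/3-sum m = begin
  N m / 3                      ≡⟨ cong (_/ 3) (N-sum m) ⟩
  sumTo m (λ j → 3 * 4 ^ j) / 3 ≡⟨ cong (_/ 3) (sym (sumTo-*ˡ m 3 (4 ^_))) ⟩
  3 * sumTo m (4 ^_) / 3       ≡⟨ cong (_/ 3) (*-comm 3 (sumTo m (4 ^_))) ⟩
  sumTo m (4 ^_) * 3 / 3       ≡⟨ m*n/n≡m (sumTo m (4 ^_)) 3 ⟩
  sumTo m (4 ^_)               ∎
  where open ≡-Reasoning

N-interleave : ∀ m → N m ≡ interleave m (const 1) (const 1)
N-interleave m = trans (N-sum m) (sym (interleave-sum m (const 1) (const 1)))

ones-binary : IsBinary (const 1)
ones-binary _ = s≤s (s≤s z≤n)

Ecount-N : ∀ m → Ecount m (N m) ≡ m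
Ecount-N m = begin
  Ecount m (N m)                                   ≡⟨ cong (Ecount m) (N-interleave m) ⟩
  Ecount m (interleave m (const 1) (const 1))      ≡⟨ Ecount-interleave m _ _ ones-binary ones-binary ⟩
  sumTo m (const 1)                                ≡⟨ sumTo-ones m ⟩
  m                                                ∎
  where open ≡-Reasoning

Ocount-N : ∀ m → Ocount m (N m) ≡ m
Ocount-N m = begin
  Ocount m (N m)                                   ≡⟨ cong (Ocount m) (N-interleave m) ⟩
  Ocount m (interleave m (const 1) (const 1))      ≡⟨ Ocount-interleave m _ _ ones-binary ones-binary ⟩
  sumTo m (const 1)                                ≡⟨ sumTo-ones m ⟩
  m                                                ∎
  where open ≡-Reasoning

indicator : ∀ {n} → Subset n → ℕ → ℕ
indicator []      i       = 0
indicator (x ∷ p) zero    = if x then 1 else 0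
indicator (x ∷ p) (suc i) = indicator p i

indicator≤1 : ∀ {n} (p : Subset n) i → indicator p i ≤ 1
indicator≤1 []          i       = z≤n
indicator≤1 (true ∷ p)  zero    = ≤-refl
indicator≤1 (false ∷ p) zero    = z≤n
indicator≤1 (x ∷ p)     (suc i) = indicator≤1 p i

indicator-∈ : ∀ {n} (p : Subset n) i (i<n : i < n) → fromℕ< i<n ∈ p → indicator p i ≡ 1
indicator-∈ (x ∷ p) zero    (s≤s z≤n) here      = refl
indicator-∈ (x ∷ p) (suc i) (s≤s i<n) (there q) = indicator-∈ p i i<n q

indicator-∉ : ∀ {n} (p : Subset n) i (i<n : i < n) → ¬ (fromℕ< i<n ∈ p) → indicator p i ≡ 0
indicator-∉ (true ∷ p)  zero    (s≤s z≤n) i∉p = ⊥-elim (i∉p here)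
indicator-∉ (false ∷ p) zero    (s≤s z≤n) i∉p = refl
indicator-∉ (x ∷ p)     (suc i) (s≤s i<n) i∉p = indicator-∉ p i i<n (i∉p ∘ there)

size-indicator : ∀ {n} (p : Subset n) → ∣ p ∣ ≡ sumTo n (indicator p)
size-indicator []                = refl
size-indicator {suc n} (true ∷ p)  =
  trans (cong suc (size-indicator p)) (sym (sumTo-shift n (indicator (true ∷ p))))
size-indicator {suc n} (false ∷ p) =
  trans (size-indicator p) (sym (sumTo-shift n (indicator (false ∷ p))))

evenWeight : ℕ → ℕ
evenWeight i = (1 ∸ i % 2) * 2 ^ i

oddWeight : ℕ → ℕ
oddWeight i = i % 2 * 2 ^ i

-- The summands of posPart and negPart are local to Defs and cannot be named,
-- so the pointwise facts leave them as `_`, determined by the use in the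
-- preceding lemma of the same mutual block.
mutual
  posPart-indicator : ∀ {n} (I : Subset n) → posPart I ≡ sumTo n (λ i → indicator I i * evenWeight i)
  posPart-indicator {n} I = sumTo-ext n (posPart-summand I)

  posPart-summand : ∀ {n} (I : Subset n) i → i < n → _ ≡ indicator I i * evenWeight i
  posPart-summand {n} I i i<n with i <? n
  ... | no i≮n = ⊥-elim (i≮n i<n)
  ... | yes i<n′ with fromℕ< i<n′ ∈? I | i % 2
  ...   | yes i∈I | zero  rewrite indicator-∈ I i i<n′ i∈I = sym (trans (*-identityˡ _) (*-identityˡ _))
  ...   | yes i∈I | suc r rewrite 0∸n≡0 r = sym (*-zeroʳ (indicator I i))
  ...   | no  i∉I | r     rewrite indicator-∉ I i i<n′ i∉I = refl

mutual
  negPart-indicator : ∀ {n} (I : Subset n) → negPart I ≡ sumTo n (λ i → indicator I i * oddWeight i)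
  negPart-indicator {n} I = sumTo-ext n (negPart-summand I)

  negPart-summand : ∀ {n} (I : Subset n) i → i < n → _ ≡ indicator I i * oddWeight i
  negPart-summand {n} I i i<n with i <? n
  ... | no i≮n = ⊥-elim (i≮n i<n)
  ... | yes i<n′ with fromℕ< i<n′ ∈? I | i % 2 | m%n<n i 2
  ...   | yes i∈I | 0           | _ = sym (*-zeroʳ (indicator I i))
  ...   | yes i∈I | 1           | _ rewrite indicator-∈ I i i<n′ i∈I = sym (trans (*-identityˡ _) (*-identityˡ _))
  ...   | yes i∈I | suc (suc r) | s≤s (s≤s ())
  ...   | no  i∉I | r           | _ rewrite indicator-∉ I i i<n′ i∉I = refl

even-mod2 : ∀ j → (2 * j) % 2 ≡ 0
even-mod2 j = bit-zero-digit 0 j (s≤s z≤n)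

odd-mod2 : ∀ j → suc (2 * j) % 2 ≡ 1
odd-mod2 j = bit-zero-digit 1 j ≤-refl

2^2j : ∀ j → 2 ^ (2 * j) ≡ 4 ^ j
2^2j j = sym (^-*-assoc 2 2 j)

evenWeight-even : ∀ j → evenWeight (2 * j) ≡ 4 ^ j
evenWeight-even j rewrite even-mod2 j = trans (+-identityʳ _) (2^2j j)

evenWeight-odd : ∀ j → evenWeight (suc (2 * j)) ≡ 0
evenWeight-odd j rewrite odd-mod2 j = refl

oddWeight-even : ∀ j → oddWeight (2 * j) ≡ 0
oddWeight-even j rewrite even-mod2 j = refl

oddWeight-odd : ∀ j → oddWeight (suc (2 * j)) ≡ 2 * 4 ^ j
oddWeight-odd j rewrite odd-mod2 j = trans (+-identityʳ _) (cong (2 *_) (2^2j j))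

module Powers {c ℓ} (R : CommutativeRing c ℓ) where
  open CommutativeRing R using (Carrier; _≈_; 1#; semiring; setoid)
    renaming (_*_ to _·_; sym to ≈-sym; *-congˡ to ·-congˡ; *-congʳ to ·-congʳ;
              *-identityˡ to ·-identityˡ; *-identityʳ to ·-identityʳ)
  open Exp semiring using () renaming (_^_ to _^ᴿ_; ^-homo-* to ^ᴿ-homo-*)
  open SetoidReasoning setoid

  pow≡^ : ∀ x n → pow R x n ≡ x ^ᴿ n
  pow≡^ x zero    = refl
  pow≡^ x (suc n) = cong (x ·_) (pow≡^ x n)

  pow-+ : ∀ x a b → pow R x (a + b) ≈ pow R x a · pow R x b
  pow-+ x a b rewrite pow≡^ x (a + b) | pow≡^ x a | pow≡^ x b = ^ᴿ-homo-* x a b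

  module _ (ζ : Carrier) where
    private
      ζ^ : ℕ → Carrier
      ζ^ = pow R ζ

    pow-multiple : ∀ N → ζ^ N ≈ 1# → ∀ k → ζ^ (N * k) ≈ 1#
    pow-multiple N ζ^N≈1 zero    = begin
      ζ^ (N * 0)  ≡⟨ cong ζ^ (*-zeroʳ N) ⟩
      1#          ∎
    pow-multiple N ζ^N≈1 (suc k) = begin
      ζ^ (N * suc k)        ≡⟨ cong ζ^ (*-suc N k) ⟩
      ζ^ (N + N * k)        ≈⟨ pow-+ ζ N (N * k) ⟩
      ζ^ N · ζ^ (N * k)     ≈⟨ ·-congʳ ζ^N≈1 ⟩
      1# · ζ^ (N * k)       ≈⟨ ·-identityˡ _ ⟩
      ζ^ (N * k)            ≈⟨ pow-multiple N ζ^N≈1 k ⟩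
      1#                    ∎

    -- … so for N > 0 the factor ζ^k is undone by ζ^((N-1)k), and it cancels.
    pow-cancel : ∀ N → 0 < N → ζ^ N ≈ 1# → ∀ a b k → ζ^ (a + k) ≈ ζ^ (b + k) → ζ^ a ≈ ζ^ b
    pow-cancel (suc n) _ ζ^N≈1 a b k ζ^a+k≈ζ^b+k = begin
      ζ^ a                        ≈⟨ undo a ⟨
      ζ^ (a + k) · ζ^ (n * k)     ≈⟨ ·-congʳ ζ^a+k≈ζ^b+k ⟩
      ζ^ (b + k) · ζ^ (n * k)     ≈⟨ undo b ⟩
      ζ^ b                        ∎
      where
      undo : ∀ x → ζ^ (x + k) · ζ^ (n * k) ≈ ζ^ x
      undo x = begin
        ζ^ (x + k) · ζ^ (n * k)   ≈⟨ pow-+ ζ (x + k) (n * k) ⟨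
        ζ^ (x + k + n * k)        ≡⟨ cong ζ^ (+-assoc x k (n * k)) ⟩
        ζ^ (x + suc n * k)        ≈⟨ pow-+ ζ x (suc n * k) ⟩
        ζ^ x · ζ^ (suc n * k)     ≈⟨ ·-congˡ (pow-multiple (suc n) ζ^N≈1 k) ⟩
        ζ^ x · 1#                 ≈⟨ ·-identityʳ _ ⟩
        ζ^ x                      ∎

    -- A primitive N-th root of unity takes distinct values at distinct
    -- exponents below N: otherwise ζ^(w-u) = 1 with 0 < w - u < N.
    pow-distinct : ∀ N → PrimitiveRoot R N ζ → ∀ u w → u < w → w < N → ¬ (ζ^ u ≈ ζ^ w)
    pow-distinct N (ζ^N≈1 , no-smaller-order) u w u<w w<N ζ^u≈ζ^w =
      no-smaller-order (w ∸ u) (m<n⇒0<n∸m u<w) (≤-<-trans (m∸n≤m w u) w<N) ζ^[w-u]≈1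
      where
      ζ^[w-u]≈1 : ζ^ (w ∸ u) ≈ 1#
      ζ^[w-u]≈1 = pow-cancel N (≤-<-trans z≤n w<N) ζ^N≈1 (w ∸ u) 0 u (begin
        ζ^ (w ∸ u + u)   ≡⟨ cong ζ^ (m∸n+n≡m (<⇒≤ u<w)) ⟩
        ζ^ w             ≈⟨ ζ^u≈ζ^w ⟨
        ζ^ u             ∎)

    pow-injective : ∀ N → PrimitiveRoot R N ζ → ∀ u w → u < N → w < N → ζ^ u ≈ ζ^ w → u ≡ w
    pow-injective N prim u w u<N w<N ζ^u≈ζ^w with <-cmp u w
    ... | tri< u<w _ _ = ⊥-elim (pow-distinct N prim u w u<w w<N ζ^u≈ζ^w)
    ... | tri≈ _ u≡w _ = u≡w
    ... | tri> _ _ w<u = ⊥-elim (pow-distinct N prim w u w<u u<N (≈-sym ζ^u≈ζ^w))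

even-shift : ∀ (x y : ℤ) → (+ 2 ∣ x) ⇔ (+ 2 ∣ (x ℤ.+ (y ℤ.+ y)))
even-shift x y = mk⇔
  (λ 2∣x → Signed.∣⇒∣ᵤ {i = x ℤ.+ (y ℤ.+ y)} (Signed.∣m∣n⇒∣m+n (Signed.∣ᵤ⇒∣ {i = x} 2∣x) 2∣y+y))
  (λ 2∣x+2y → Signed.∣⇒∣ᵤ {i = x} (Signed.∣m+n∣n⇒∣m (Signed.∣ᵤ⇒∣ {i = x ℤ.+ (y ℤ.+ y)} 2∣x+2y) 2∣y+y))
  where
  2∣y+y : + 2 Signed.∣ (y ℤ.+ y)
  2∣y+y = Signed.divides y (double y)
    where
    double : ∀ (y : ℤ) → y ℤ.+ y ≡ y ℤ.* + 2
    double = ℤ-Solver.solve-∀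

-- From O + k = m + E and wt = E + O: O - E = m - k, and wt ≡ m - k (mod 2)
-- because wt = (O - E) + 2E.
difference-and-parity : ∀ (O E k m wt : ℕ) → O + k ≡ m + E → wt ≡ E + O →
  (+ O - + E ≡ + m - + k) × ((+ 2 ∣ + wt) ⇔ (+ 2 ∣ (+ m - + k)))
difference-and-parity O E k m wt O+k≡m+E wt≡E+O = difference , same-parity
  where
  open ≡-Reasoning
  difference : + O - + E ≡ + m - + k
  difference = begin
    + O - + E                            ≡⟨ add-both (+ O) (+ E) (+ k) ⟩
    (+ O ℤ.+ + k) - (+ E ℤ.+ + k)        ≡⟨ cong (_- (+ E ℤ.+ + k)) (sym (ℤ.pos-+ O k)) ⟩
    + (O + k) - (+ E ℤ.+ + k)            ≡⟨ cong (λ x → + x - (+ E ℤ.+ + k)) O+k≡m+E ⟩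
    + (m + E) - (+ E ℤ.+ + k)            ≡⟨ cong (_- (+ E ℤ.+ + k)) (ℤ.pos-+ m E) ⟩
    (+ m ℤ.+ + E) - (+ E ℤ.+ + k)        ≡⟨ cancel-E (+ m) (+ E) (+ k) ⟩
    + m - + k                            ∎
    where
    add-both : ∀ (p q r : ℤ) → p - q ≡ (p ℤ.+ r) - (q ℤ.+ r)
    add-both = ℤ-Solver.solve-∀
    cancel-E : ∀ (p q r : ℤ) → (p ℤ.+ q) - (q ℤ.+ r) ≡ p - r
    cancel-E = ℤ-Solver.solve-∀
  wt-split : + wt ≡ (+ m - + k) ℤ.+ (+ E ℤ.+ + E)
  wt-split = begin
    + wt                                 ≡⟨ cong +_ wt≡E+O ⟩
    + (E + O)                            ≡⟨ ℤ.pos-+ E O ⟩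
    + E ℤ.+ + O                          ≡⟨ regroup (+ O) (+ E) ⟩
    (+ O - + E) ℤ.+ (+ E ℤ.+ + E)        ≡⟨ cong (ℤ._+ (+ E ℤ.+ + E)) difference ⟩
    (+ m - + k) ℤ.+ (+ E ℤ.+ + E)        ∎
    where
    regroup : ∀ (p q : ℤ) → q ℤ.+ p ≡ (p - q) ℤ.+ (q ℤ.+ q)
    regroup = ℤ-Solver.solve-∀
  same-parity : (+ 2 ∣ + wt) ⇔ (+ 2 ∣ (+ m - + k))
  same-parity = mk⇔
    (λ 2∣wt → Equivalence.from (even-shift (+ m - + k) (+ E)) (subst (+ 2 ∣_) wt-split 2∣wt))
    (λ 2∣m-k → subst (+ 2 ∣_) (sym wt-split) (Equivalence.to (even-shift (+ m - + k) (+ E)) 2∣m-k))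

module Candidate (m : ℕ) (I : Subset (2 * m)) where

  a b c : ℕ → ℕ
  a j = indicator I (2 * j)
  b j = indicator I (suc (2 * j))
  c j = 1 ∸ b j

  a-binary : IsBinary a
  a-binary j = s≤s (indicator≤1 I (2 * j))

  c-binary : IsBinary c
  c-binary j = s≤s (m∸n≤m 1 (b j))

  c+b≡1 : ∀ j → c j + b j ≡ 1
  c+b≡1 j = m∸n+n≡m (indicator≤1 I (suc (2 * j)))

  v : ℕ
  v = interleave m a c

  posPart-digits : posPart I ≡ sumTo m (λ j → a j * 4 ^ j)
  posPart-digits = begin
    posPart I                                                  ≡⟨ posPart-indicator I ⟩
    sumTo (2 * m) (λ i → indicator I i * evenWeight i)          ≡⟨ sumTo-pairs m _ ⟩
    sumTo m (λ j → a j * evenWeight (2 * j) + b j * evenWeight (suc (2 * j)))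
      ≡⟨ sumTo-ext m (λ j _ → cong₂ (λ x y → a j * x + b j * y) (evenWeight-even j) (evenWeight-odd j)) ⟩
    sumTo m (λ j → a j * 4 ^ j + b j * 0)                       ≡⟨ sumTo-ext m (λ j _ → drop-zero (a j * 4 ^ j) (b j)) ⟩
    sumTo m (λ j → a j * 4 ^ j)                                 ∎
    where
    open ≡-Reasoning
    drop-zero : ∀ x y → x + y * 0 ≡ x
    drop-zero x y = trans (cong (λ z → x + z) (*-zeroʳ y)) (+-identityʳ x)

  negPart-digits : negPart I ≡ sumTo m (λ j → b j * (2 * 4 ^ j))
  negPart-digits = begin
    negPart I                                                  ≡⟨ negPart-indicator I ⟩
    sumTo (2 * m) (λ i → indicator I i * oddWeight i)           ≡⟨ sumTo-pairs m _ ⟩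
    sumTo m (λ j → a j * oddWeight (2 * j) + b j * oddWeight (suc (2 * j)))
      ≡⟨ sumTo-ext m (λ j _ → cong₂ (λ x y → a j * x + b j * y) (oddWeight-even j) (oddWeight-odd j)) ⟩
    sumTo m (λ j → a j * 0 + b j * (2 * 4 ^ j))                 ≡⟨ sumTo-ext m (λ j _ → cong (_+ b j * (2 * 4 ^ j)) (*-zeroʳ (a j))) ⟩
    sumTo m (λ j → b j * (2 * 4 ^ j))                           ∎
    where open ≡-Reasoning

  size-digits : ∣ I ∣ ≡ sumTo m (λ j → a j + b j)
  size-digits = trans (size-indicator I) (sumTo-pairs m (indicator I))

  -- The exponent identity  v + N/3 + negPart I = posPart I + N,  digit by
  -- digit:  (a + 2c)·4^j + (4^j + b·2·4^j) = a·4^j + 3·4^j  as c + b = 1.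
  exponent-identity : v + (N m / 3 + negPart I) ≡ posPart I + N m
  exponent-identity = begin
    v + (N m / 3 + negPart I)
      ≡⟨ cong₂ (λ x y → x + (y + negPart I)) (interleave-sum m a c) (N/3-sum m) ⟩
    sumTo m (λ j → d j * 4 ^ j) + (sumTo m (4 ^_) + negPart I)
      ≡⟨ cong (λ x → sumTo m (λ j → d j * 4 ^ j) + (sumTo m (4 ^_) + x)) negPart-digits ⟩
    sumTo m (λ j → d j * 4 ^ j) + (sumTo m (4 ^_) + sumTo m (λ j → b j * (2 * 4 ^ j)))
      ≡⟨ cong (λ x → sumTo m (λ j → d j * 4 ^ j) + x) (sumTo-+ m _ _) ⟩
    sumTo m (λ j → d j * 4 ^ j) + sumTo m (λ j → 4 ^ j + b j * (2 * 4 ^ j))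
      ≡⟨ sumTo-+ m _ _ ⟩
    sumTo m (λ j → d j * 4 ^ j + (4 ^ j + b j * (2 * 4 ^ j)))
      ≡⟨ sumTo-ext m (λ j _ → digit-identity (a j) (b j) (c j) (4 ^ j) (c+b≡1 j)) ⟩
    sumTo m (λ j → a j * 4 ^ j + 3 * 4 ^ j)
      ≡⟨ sumTo-+ m _ _ ⟨
    sumTo m (λ j → a j * 4 ^ j) + sumTo m (λ j → 3 * 4 ^ j)
      ≡⟨ cong₂ _+_ posPart-digits (N-sum m) ⟨
    posPart I + N m ∎
    where
    open ≡-Reasoning
    d : ℕ → ℕ
    d j = a j + 2 * c j
    expand : ∀ a b c x → (a + 2 * c) * x + (x + b * (2 * x)) ≡ a * x + (1 + 2 * (c + b)) * x
    expand = solve-∀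
    digit-identity : ∀ a b c x → c + b ≡ 1 → (a + 2 * c) * x + (x + b * (2 * x)) ≡ a * x + 3 * x
    digit-identity a b c x c+b≡1 = trans (expand a b c x) (cong (λ s → a * x + (1 + 2 * s) * x) c+b≡1)

  -- Every base-4 digit of v is at most 3, so v ≤ N.
  v≤N : v ≤ N m
  v≤N = begin
    v                                    ≡⟨ interleave-sum m a c ⟩
    sumTo m (λ j → (a j + 2 * c j) * 4 ^ j)
      ≤⟨ sumTo-mono m (λ j → *-monoˡ-≤ (4 ^ j) (+-mono-≤ (indicator≤1 I (2 * j)) (*-monoʳ-≤ 2 (m∸n≤m 1 (b j))))) ⟩
    sumTo m (λ j → 3 * 4 ^ j)            ≡⟨ N-sum m ⟨
    N m                                  ∎
    where open ≤-Reasoning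

  count-identity : Ocount m v + ∣ I ∣ ≡ m + Ecount m v
  count-identity = begin
    Ocount m v + ∣ I ∣                   ≡⟨ cong₂ _+_ (Ocount-interleave m a c a-binary c-binary) size-digits ⟩
    sumTo m c + sumTo m (λ j → a j + b j) ≡⟨ sumTo-+ m _ _ ⟩
    sumTo m (λ j → c j + (a j + b j))    ≡⟨ sumTo-ext m (λ j _ → trans (regroup (a j) (b j) (c j)) (cong (_+ a j) (c+b≡1 j))) ⟩
    sumTo m (λ j → 1 + a j)              ≡⟨ sumTo-+ m _ _ ⟨
    sumTo m (const 1) + sumTo m a        ≡⟨ cong₂ _+_ (sumTo-ones m) (sym (Ecount-interleave m a c a-binary c-binary)) ⟩
    m + Ecount m v                       ∎
    where
    open ≡-Reasoning
    regroup : ∀ a b c → c + (a + b) ≡ (c + b) + a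
    regroup = solve-∀

  -- If v = N then all digits a_j, c_j are 1, which forces |I| = m.
  full-candidate : v ≡ N m → ∣ I ∣ ≡ m
  full-candidate v≡N = +-cancelˡ-≡ m ∣ I ∣ m (begin
    m + ∣ I ∣            ≡⟨ cong (_+ ∣ I ∣) (trans (cong (Ocount m) v≡N) (Ocount-N m)) ⟨
    Ocount m v + ∣ I ∣   ≡⟨ count-identity ⟩
    m + Ecount m v       ≡⟨ cong (λ e → m + e) (trans (cong (Ecount m) v≡N) (Ecount-N m)) ⟩
    m + m                ∎)
    where open ≡-Reasoning

module _ {c ℓ} (R : CommutativeRing c ℓ) where
  open CommutativeRing R using (Carrier; _≈_; 1#; setoid)
    renaming (_*_ to _·_; *-congˡ to ·-congˡ; *-assoc to ·-assoc; *-identityʳ to ·-identityʳ)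
  open SetoidReasoning setoid
  open Powers R

  -- The hypothesis on u says ζ^u = ζ^v for the candidate v: multiplying by
  -- ζ^N = 1 turns it into ζ^(u + k) = ζ^(v + k), and ζ^k cancels.
  hypothesis⇒candidate : ∀ m ζ → pow R ζ (N m) ≈ 1# → 0 < N m → (I : Subset (2 * m)) → ∀ u →
    (pow R ζ u · pow R ζ (N m / 3)) · pow R ζ (negPart I) ≈ pow R ζ (posPart I) →
    pow R ζ u ≈ pow R ζ (Candidate.v m I)
  hypothesis⇒candidate m ζ ζ^N≈1 0<N I u hyp =
    pow-cancel ζ (N m) 0<N ζ^N≈1 u v (N m / 3 + negPart I) (begin
      ζ^ (u + (N m / 3 + negPart I))                 ≈⟨ pow-+ ζ u _ ⟩
      ζ^ u · ζ^ (N m / 3 + negPart I)                ≈⟨ ·-congˡ (pow-+ ζ (N m / 3) (negPart I)) ⟩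
      ζ^ u · (ζ^ (N m / 3) · ζ^ (negPart I))         ≈⟨ ·-assoc _ _ _ ⟨
      (ζ^ u · ζ^ (N m / 3)) · ζ^ (negPart I)         ≈⟨ hyp ⟩
      ζ^ (posPart I)                                 ≈⟨ ·-identityʳ _ ⟨
      ζ^ (posPart I) · 1#                            ≈⟨ ·-congˡ ζ^N≈1 ⟨
      ζ^ (posPart I) · ζ^ (N m)                      ≈⟨ pow-+ ζ (posPart I) (N m) ⟨
      ζ^ (posPart I + N m)                           ≡⟨ cong ζ^ (Candidate.exponent-identity m I) ⟨
      ζ^ (v + (N m / 3 + negPart I))                 ∎)
    where
    v : ℕ
    v = Candidate.v m I
    ζ^ : ℕ → Carrier
    ζ^ = pow R ζ

-- Either u = v, or v = N and then u = 0 and |I| = m; in both cases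
-- O(u) + |I| = m + E(u), and the rest is integer bookkeeping.
lemma6p7 : ∀ {c ℓ : Level} (R : CommutativeRing c ℓ) → Char2 R →
    (m : ℕ) → 1 ≤ m →
    (ζ : CommutativeRing.Carrier R) → PrimitiveRoot R (N m) ζ →
    (I : Subset (2 * m)) → (u : ℕ) → u < N m →
    CommutativeRing._≈_ R
      (CommutativeRing._*_ R (CommutativeRing._*_ R (pow R ζ u) (pow R ζ (N m / 3))) (pow R ζ (negPart I)))
      (pow R ζ (posPart I)) →
    ((+ Ocount m u - + Ecount m u) ≡ (+ m - + ∣ I ∣))
    × ((+ 2 ∣ + wt₂ m u) ⇔ (+ 2 ∣ (+ m - + ∣ I ∣)))
lemma6p7 R _ m _ ζ ζ-primitive@(ζ^N≈1 , _) I u u<N hyp =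
  difference-and-parity (Ocount m u) (Ecount m u) ∣ I ∣ m (wt₂ m u) counts (wt₂-split m u)
  where
  open Candidate m I using (v; v≤N; count-identity; full-candidate)
  open Powers R using (pow-injective)
  open CommutativeRing R using () renaming (trans to ≈-trans; reflexive to ≈-reflexive)

  0<N : 0 < N m
  0<N = ≤-<-trans z≤n u<N

  ζ^u≈ζ^v : CommutativeRing._≈_ R (pow R ζ u) (pow R ζ v)
  ζ^u≈ζ^v = hypothesis⇒candidate R m ζ ζ^N≈1 0<N I u hyp

  -- In the exceptional case ζ^u = ζ^N = 1 = ζ^0.
  u≡0 : v ≡ N m → u ≡ 0
  u≡0 v≡N = pow-injective ζ (N m) ζ-primitive u 0 u<N 0<N
    (≈-trans ζ^u≈ζ^v (≈-trans (≈-reflexive (cong (pow R ζ) v≡N)) ζ^N≈1))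

  counts : Ocount m u + ∣ I ∣ ≡ m + Ecount m u
  counts with m≤n⇒m<n∨m≡n v≤N
  ... | inj₁ v<N rewrite pow-injective ζ (N m) ζ-primitive u v u<N v<N ζ^u≈ζ^v = count-identity
  ... | inj₂ v≡N = begin
    Ocount m u + ∣ I ∣   ≡⟨ cong₂ _+_ (trans (cong (Ocount m) (u≡0 v≡N)) (Ocount-zero m)) (full-candidate v≡N) ⟩
    m                    ≡⟨ +-identityʳ m ⟨
    m + 0                ≡⟨ cong (λ e → m + e) (trans (cong (Ecount m) (u≡0 v≡N)) (Ecount-zero m)) ⟨
    m + Ecount m u       ∎
    where open ≡-Reasoning
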